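{- Let $A\subseteq\mathfrak S_n$ be $\operatorname{cDes}$-invariant. Assume there are nonnegative integers $(m_{\lambda/\mu})$, indexed by skew shapes $\lambda/\mu$ with $n$ cells, such that $\sum_{\pi\in A}\mathbf x^{\operatorname{Des}(\pi)}=\sum_{\lambda/\mu}m_{\lambda/\mu}\sum_{T\in\operatorname{SYT}(\lambda/\mu)}\mathbf x^{\operatorname{Des}(T)}$, and assume $m_{\lambda/\mu}=0$ whenever $\lambda/\mu$ is a connected ribbon. Then $A$ is cyclic Schur-positive.
   Context: $[n]=\{1,\dots,n\}$; for $D\subseteq[n]$, $i+D:=\{i+d \bmod n: d\in D\}\subseteq[n]$. For $\pi\in\mathfrak{S}_n$: $\operatorname{Des}(\pi)=\{i\in[n-1]:\pi(i)>\pi(i+1)\}$, $\operatorname{cDes}(\pi)=\{i\in[n]:\pi(i)>\pi(i+1)\}$ with $\pi(n+1):=\pi(1)$. $\mathbf{x}^J=\prod_{i\in J}x_i$. $A$ is $\operatorname{cDes}$-invariant if there is a bijection $\psi:A\to A$ with $\operatorname{cDes}(\psi\pi)=1+\operatorname{cDes}(\pi)$ for all $\pi\in A$. For a skew shape $\lambda/\mu$ with $n$ cells, $\operatorname{SYT}(\lambda/\mu)$ is its set of standard Young tableaux (English notation), $\operatorname{Des}(T)=\{i\in[n-1]: i+1$ in a lower row than $i\}$. A connected ribbon is a connected skew shape containing no $2\times2$ square. A cyclic descent extension on $\operatorname{SYT}(\lambda/\mu)$ is a pair $(\operatorname{cDes},\psi)$, $\operatorname{cDes}:\operatorname{SYT}(\lambda/\mu)\to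 2^{[n]}$, $\psi$ a bijection of $\operatorname{SYT}(\lambda/\mu)$, with $\operatorname{cDes}(T)\cap[n-1]=\operatorname{Des}(T)$, $\operatorname{cDes}(\psi T)=1+\operatorname{cDes}(T)$ and $\emptyset\subsetneq\operatorname{cDes}(T)\subsetneq[n]$ for all $T$; it exists iff $\lambda/\mu$ is not a connected ribbon, and then $\sum_{T}\mathbf x^{\operatorname{cDes}(T)}$ is independent of the choice. $A$ is cyclic Schur-positive if there are nonnegative integers $m'_{\lambda/\mu}$, indexed by skew shapes with $n$ cells that are not connected ribbons, with $\sum_{\pi\in A}\mathbf x^{\operatorname{cDes}(\pi)}=\sum_{\lambda/\mu}m'_{\lambda/\mu}\sum_{T\in\operatorname{SYT}(\lambda/\mu)}\mathbf x^{\operatorname{cDes}(T)}$. -}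

module Defs where

open import Data.Bool using (Bool; true; false; _∧_)
open import Data.Nat using (ℕ; zero; suc; _+_; _<_; _≤_; _<ᵇ_)
open import Data.Nat.Properties using (suc-injective)
open import Data.Fin using (Fin; toℕ; lower₁)
import Data.Fin as F
open import Data.Fin.Subset using (Subset; _∩_) renaming (⊥ to ∅ˢ; ⊤ to fullˢ)
open import Data.Vec using (Vec; []; _∷_; lookup; tabulate; last; init)
open import Data.List using (List; []; _∷_; map; _++_)
open import Data.Nat.ListAction using (sum)
open import Data.List.Membership.Propositional using (_∈_)
open import Data.List.Relation.Unary.All using (All; []; _∷_)
open import Data.List.Relation.Unary.Unique.Propositional using (Unique)
open import Data.Product using (Σ; _×_; _,_; ∃; proj₁; proj₂)
open import Relation.Nullary using (¬_; yes; no)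
open import Relation.Binary.PropositionalEquality using (_≡_; _≢_)
open import Function using (_∘_)

-- Conventions.  The ground set [n] = {1,…,n} is represented by Fin n:
-- the index k : Fin n stands for the element (toℕ k + 1).
-- Subsets of [n] are Data.Fin.Subset n (bit vectors).

cyc : ∀ {n} → Fin n → Fin n
cyc {suc m} i with m Data.Nat.≟ toℕ i
... | yes _ = F.zero
... | no ne = lower₁ (F.suc i) (ne ∘ suc-injective)

below : ∀ n → Subset n
below n = tabulate (λ (k : Fin n) → suc (toℕ k) <ᵇ n)

-- 1 + J = { i+1 mod n : i ∈ J }  (rotate the bit vector by one step)
shift : ∀ {n} → Subset n → Subset n
shift {zero}  J = J
shift {suc m} J = last J ∷ init J

-- Permutations in one-line notation: π = (π(1),…,π(n)).

Perm : ℕ → Set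
Perm n = Vec (Fin n) n

IsPerm : ∀ {n} → Perm n → Set
IsPerm {n} π = ∀ (i j : Fin n) → lookup π i ≡ lookup π j → i ≡ j

cDes : ∀ {n} → Perm n → Subset n
cDes {n} π = tabulate (λ k → toℕ (lookup π (cyc k)) <ᵇ toℕ (lookup π k))

-- Des(π) = { i ∈ [n-1] : π(i) > π(i+1) }  (for i ∈ [n-1], cyc i = i+1)
Des : ∀ {n} → Perm n → Subset n
Des {n} π = tabulate (λ k → (suc (toℕ k) <ᵇ n) ∧ (toℕ (lookup π (cyc k)) <ᵇ toℕ (lookup π k)))

record PermSet (n : ℕ) : Set where
  field
    elems   : List (Perm n)
    perms   : All IsPerm elems
    nodup   : Unique elems
open PermSet public

CDesInvariant : ∀ {n} → PermSet n → Set
CDesInvariant {n} A =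
  Σ (Perm n → Perm n) λ ψ → Σ (Perm n → Perm n) λ φ →
    (∀ π → π ∈ elems A → ψ π ∈ elems A) ×
    (∀ π → π ∈ elems A → φ π ∈ elems A) ×
    (∀ π → π ∈ elems A → φ (ψ π) ≡ π) ×
    (∀ π → π ∈ elems A → ψ (φ π) ≡ π) ×
    (∀ π → π ∈ elems A → cDes (ψ π) ≡ shift (cDes π))

-- Partitions and skew shapes (rows/columns indexed from 0, English notation:
-- row i+1 lies below row i).

rowLen : List ℕ → ℕ → ℕ
rowLen []       _       = 0
rowLen (x ∷ xs) zero    = x
rowLen (x ∷ xs) (suc i) = rowLen xs i

data IsPartition : List ℕ → Set where
  nil  : IsPartition []
  one  : ∀ {x} → 1 ≤ x → IsPartition (x ∷ [])
  cons : ∀ {x y ys} → y ≤ x → IsPartition (y ∷ ys) → IsPartition (x ∷ y ∷ ys)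

record SkewShape (n : ℕ) : Set where
  field
    outer  : List ℕ
    inner  : List ℕ
    outerP : IsPartition outer
    innerP : IsPartition inner
    contained : ∀ i → rowLen inner i ≤ rowLen outer i
    size   : sum outer ≡ sum inner + n
open SkewShape public

Cell : Set
Cell = ℕ × ℕ

InShape : ∀ {n} → SkewShape n → Cell → Set
InShape s (i , j) = rowLen (inner s) i ≤ j × j < rowLen (outer s) i

data Adj : Cell → Cell → Set where
  right : ∀ i j → Adj (i , j) (i , suc j)
  left  : ∀ i j → Adj (i , suc j) (i , j)
  down  : ∀ i j → Adj (i , j) (suc i , j)
  up    : ∀ i j → Adj (suc i , j) (i , j)

data Path {n} (s : SkewShape n) : Cell → Cell → Set where
  here : ∀ {c} → Path s c c
  step : ∀ {c d e} → InShape s d → Adj c d → Path s d e → Path s c e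

Connected : ∀ {n} → SkewShape n → Set
Connected s = ∀ c d → InShape s c → InShape s d → Path s c d

Contains2x2 : ∀ {n} → SkewShape n → Set
Contains2x2 s = Σ ℕ λ i → Σ ℕ λ j →
  InShape s (i , j) × InShape s (i , suc j) ×
  InShape s (suc i , j) × InShape s (suc i , suc j)

ConnectedRibbon : ∀ {n} → SkewShape n → Set
ConnectedRibbon s = Connected s × ¬ Contains2x2 s

-- Standard Young tableaux.  A filling with entries 1,…,n is recorded by
-- the cell of each entry: T[k] is the cell containing the entry k+1.

Tab : ℕ → Set
Tab n = Vec Cell n

row col : Cell → ℕ
row = proj₁
col = proj₂

IsSYT : ∀ {n} → SkewShape n → Tab n → Set
IsSYT {n} s T =
  (∀ k → InShape s (lookup T k)) ×
  (∀ c → InShape s c → Σ (Fin n) λ k → lookup T k ≡ c) ×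
  (∀ k l → lookup T k ≡ lookup T l → k ≡ l) ×
  (∀ k l → row (lookup T k) ≡ row (lookup T l) → col (lookup T k) < col (lookup T l) → toℕ k < toℕ l) ×
  (∀ k l → col (lookup T k) ≡ col (lookup T l) → row (lookup T k) < row (lookup T l) → toℕ k < toℕ l)

DesT : ∀ {n} → Tab n → Subset n
DesT {n} T = tabulate (λ k → (suc (toℕ k) <ᵇ n) ∧ (row (lookup T k) <ᵇ row (lookup T (cyc k))))

record Enumerates {X : Set} (P : X → Set) (xs : List X) : Set where
  field
    nodupE   : Unique xs
    sound    : ∀ x → x ∈ xs → P x
    complete : ∀ x → P x → x ∈ xs

record CycDesExt {n} (s : SkewShape n) : Set where
  field
    cDesT : Tab n → Subset n
    ψ     : Tab n → Tab n
    ψ⁻¹   : Tab n → Tab n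
    ψ-syt   : ∀ T → IsSYT s T → IsSYT s (ψ T)
    ψ⁻¹-syt : ∀ T → IsSYT s T → IsSYT s (ψ⁻¹ T)
    ψ⁻¹ψ    : ∀ T → IsSYT s T → ψ⁻¹ (ψ T) ≡ T
    ψψ⁻¹    : ∀ T → IsSYT s T → ψ (ψ⁻¹ T) ≡ T
    extends : ∀ T → IsSYT s T → cDesT T ∩ below n ≡ DesT T
    equivar : ∀ T → IsSYT s T → cDesT (ψ T) ≡ shift (cDesT T)
    nonEmpty : ∀ T → IsSYT s T → cDesT T ≢ ∅ˢ
    nonFull  : ∀ T → IsSYT s T → cDesT T ≢ fullˢ
open CycDesExt public

-- Generating functions Σ x^J are represented by the multiset (list) of
-- exponent sets J; equality of such polynomials is ↭ of these lists.
-- A family (m_{λ/μ}) of nonnegative integers with finite support is a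
-- list of shapes in which λ/μ occurs m_{λ/μ} times.

schurDesGF : ∀ {n} → ((s : SkewShape n) → List (Tab n)) → List (SkewShape n) → List (Subset n)
schurDesGF enum []      = []
schurDesGF enum (s ∷ L) = map DesT (enum s) ++ schurDesGF enum L

schurCDesGF : ∀ {n} → ((s : SkewShape n) → List (Tab n)) →
              (L : List (SkewShape n)) → All CycDesExt L → List (Subset n)
schurCDesGF enum []      []       = []
schurCDesGF enum (s ∷ L) (e ∷ es) = map (cDesT e) (enum s) ++ schurCDesGF enum L es

-- Both sides of the desired identity are multisets of subsets of [n] (cDes(A), and
-- the cyclic descent sets of the tableaux for any choice of cyclic descent
-- extensions).  Each is rotation invariant (cDes-invariance of A, equivariance of the
-- extensions), neither contains [n] (a permutation has a cyclic ascent at its minimal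
-- value; extensions are proper), and their linear parts J ∩ [n-1] agree by hypothesis.
-- The key fact is that these properties determine a multiset (linearPart-determines):
-- comparing multiplicities, a subset with a hole is rotated until it misses n, and its
-- multiplicity is then the known multiplicity of its linear part minus that of the
-- subset with n added, which has one hole less; induct on the number of holes.
-- (This is for n ≥ 1; for n = 0 the linear part is the identity.)
module Submission where

import Data.Bool as Bool
open import Data.Bool using (Bool; true; false; _∧_; T)
import Data.Bool.Properties as BoolP
open import Data.Empty using (⊥-elim)
open import Data.Fin using (Fin; toℕ)
import Data.Fin as Fin
import Data.Fin.Properties as FP
open import Data.Fin.Subset using (Subset; _∩_) renaming (⊤ to fullˢ)
open import Data.List using (List; []; _∷_; _++_; map; filter; length; allFin)
import Data.List.Properties as LP
open import Data.List.Extrema.Nat using (argmin; f[argmin]≤f[xs])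
open import Data.List.Membership.Propositional using (_∈_; _∉_)
open import Data.List.Membership.Propositional.Properties
  using (∈-∃++; ∈-map⁺; ∈-map⁻; ∈-allFin; ∈-++⁻)
open import Data.List.Relation.Binary.Permutation.Propositional
  using (_↭_; ↭-refl; ↭-sym; ↭-trans; prep; module PermutationReasoning)
import Data.List.Relation.Binary.Permutation.Propositional.Properties as PermP
open import Data.List.Relation.Unary.All using (All; []; _∷_)
import Data.List.Relation.Unary.All as All
import Data.List.Relation.Unary.All.Properties as AllP
open import Data.List.Relation.Unary.AllPairs using ([]; _∷_)
open import Data.List.Relation.Unary.Any using (here; there)
open import Data.List.Relation.Unary.Unique.Propositional using (Unique)
open import Data.Nat using (ℕ; zero; suc; _+_; _∸_; _<_; _≤_; _<ᵇ_; s≤s; s≤s⁻¹; z≤n)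
open import Data.Nat.GeneralisedArithmetic using (iterate)
import Data.Nat.Properties as ℕ
open import Algebra.Properties.CommutativeSemigroup ℕ.+-commutativeSemigroup using (interchange)
open import Data.Product using (Σ; ∃; _×_; _,_; proj₂)
import Data.Product.Properties as ProdP
open import Data.Sum using (_⊎_; inj₁; inj₂)
open import Data.Vec using (Vec; []; _∷_; _∷ʳ_; lookup; tabulate; initLast; init; last)
import Data.Vec.Properties as VP
open import Defs
open import Function using (_∘_)
open import Relation.Binary.Definitions using (DecidableEquality)
open import Relation.Binary.PropositionalEquality
  using (_≡_; _≢_; refl; sym; trans; cong; cong₂; subst; subst₂; module ≡-Reasoning)
open import Relation.Nullary using (¬_; yes; no)

module Multiplicity {X : Set} (_≟_ : DecidableEquality X) where

  open import Data.List.Membership.DecPropositional _≟_ using (_∈?_)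

  count : X → List X → ℕ
  count x xs = length (filter (x ≟_) xs)

  δ : X → X → ℕ
  δ x y = count x (y ∷ [])

  count-∷ : ∀ x y ys → count x (y ∷ ys) ≡ δ x y + count x ys
  count-∷ x y ys with x ≟ y
  ... | yes _ = refl
  ... | no _  = refl

  δ-refl : ∀ x → δ x x ≡ 1
  δ-refl x with x ≟ x
  ... | yes _  = refl
  ... | no x≢x = ⊥-elim (x≢x refl)

  δ-≢ : ∀ {x y} → x ≢ y → δ x y ≡ 0
  δ-≢ {x} {y} x≢y with x ≟ y
  ... | yes x≡y = ⊥-elim (x≢y x≡y)
  ... | no _    = refl

  count-↭ : ∀ x {xs ys} → xs ↭ ys → count x xs ≡ count x ys
  count-↭ x p = PermP.↭-length (PermP.filter-↭ (x ≟_) p)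

  count-pos⇒∈ : ∀ x ys → 0 < count x ys → x ∈ ys
  count-pos⇒∈ x (y ∷ ys) pos with x ≟ y
  ... | yes refl = here refl
  ... | no _     = there (count-pos⇒∈ x ys pos)

  count-head : ∀ x xs → 0 < count x (x ∷ xs)
  count-head x xs with x ≟ x
  ... | yes _  = s≤s z≤n
  ... | no x≢x = ⊥-elim (x≢x refl)

  ∈⇒↭∷ : ∀ {x : X} {ys} → x ∈ ys → ∃ λ zs → ys ↭ x ∷ zs
  ∈⇒↭∷ {x} x∈ys with h , t , refl ← ∈-∃++ x∈ys = h ++ t , PermP.shift x h t

  ↭-from-count : ∀ xs ys → (∀ z → count z xs ≡ count z ys) → xs ↭ ys
  ↭-from-count []       []       same = ↭-refl
  ↭-from-count []       (y ∷ ys) same with () ← subst (0 <_) (sym (same y)) (count-head y ys)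
  ↭-from-count (x ∷ xs) ys       same
    with zs , ys↭x∷zs ← ∈⇒↭∷ (count-pos⇒∈ x ys (subst (0 <_) (same x) (count-head x xs)))
    = ↭-trans (prep x (↭-from-count xs zs same-tail)) (↭-sym ys↭x∷zs)
    where
    same-tail : ∀ z → count z xs ≡ count z zs
    same-tail z = ℕ.+-cancelˡ-≡ (δ z x) _ _ (begin
      δ z x + count z xs   ≡⟨ sym (count-∷ z x xs) ⟩
      count z (x ∷ xs)     ≡⟨ same z ⟩
      count z ys           ≡⟨ count-↭ z ys↭x∷zs ⟩
      count z (x ∷ zs)     ≡⟨ count-∷ z x zs ⟩
      δ z x + count z zs   ∎)
      where open ≡-Reasoning

  count-map-injective : ∀ (f : X → X) → (∀ {a b} → f a ≡ f b → a ≡ b) →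
    ∀ x M → count (f x) (map f M) ≡ count x M
  count-map-injective f inj x []      = refl
  count-map-injective f inj x (y ∷ M) = begin
    count (f x) (f y ∷ map f M)            ≡⟨ count-∷ (f x) (f y) (map f M) ⟩
    δ (f x) (f y) + count (f x) (map f M)  ≡⟨ cong₂ _+_ δ-image (count-map-injective f inj x M) ⟩
    δ x y + count x M                      ≡⟨ sym (count-∷ x y M) ⟩
    count x (y ∷ M)                        ∎
    where
    open ≡-Reasoning
    δ-image : δ (f x) (f y) ≡ δ x y
    δ-image with x ≟ y
    ... | yes refl = δ-refl (f x)
    ... | no x≢y   = δ-≢ (x≢y ∘ inj)

  count-map-fibre₂ : ∀ (f : X → X) {y a b} → a ≢ b → f a ≡ y → f b ≡ y →
    (∀ x → f x ≡ y → x ≡ a ⊎ x ≡ b) →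
    ∀ M → count y (map f M) ≡ count a M + count b M
  count-map-fibre₂ f {y} {a} {b} a≢b fa fb fibre []      = refl
  count-map-fibre₂ f {y} {a} {b} a≢b fa fb fibre (x ∷ M) = begin
    count y (f x ∷ map f M)
      ≡⟨ count-∷ y (f x) (map f M) ⟩
    δ y (f x) + count y (map f M)
      ≡⟨ cong₂ _+_ δ-image (count-map-fibre₂ f a≢b fa fb fibre M) ⟩
    (δ a x + δ b x) + (count a M + count b M)
      ≡⟨ interchange (δ a x) (δ b x) (count a M) (count b M) ⟩
    (δ a x + count a M) + (δ b x + count b M)
      ≡⟨ sym (cong₂ _+_ (count-∷ a x M) (count-∷ b x M)) ⟩
    count a (x ∷ M) + count b (x ∷ M)
      ∎
    where
    open ≡-Reasoning
    δ-image : δ y (f x) ≡ δ a x + δ b x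
    δ-image with y ≟ f x
    ... | yes y≡fx with fibre x (sym y≡fx)
    ...   | inj₁ refl = cong₂ _+_ (sym (δ-refl a)) (sym (δ-≢ (a≢b ∘ sym)))
    ...   | inj₂ refl = cong₂ _+_ (sym (δ-≢ a≢b)) (sym (δ-refl b))
    δ-image | no y≢fx =
      sym (cong₂ _+_ (δ-≢ λ { refl → y≢fx (sym fa) }) (δ-≢ λ { refl → y≢fx (sym fb) }))

  count-∉ : ∀ {x} xs → x ∉ xs → count x xs ≡ 0
  count-∉ {x} []       x∉xs = refl
  count-∉ {x} (y ∷ ys) x∉xs with x ≟ y
  ... | yes refl = ⊥-elim (x∉xs (here refl))
  ... | no _     = count-∉ ys (x∉xs ∘ there)

  count-unique : ∀ {x xs} → Unique xs → x ∈ xs → count x xs ≡ 1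
  count-unique {x} {y ∷ ys} (y∉ys ∷ _) (here refl) with x ≟ x
  ... | yes _  = cong suc (count-∉ ys λ y∈ys → All.lookup y∉ys y∈ys refl)
  ... | no x≢x = ⊥-elim (x≢x refl)
  count-unique {x} {y ∷ ys} (y∉ys ∷ u) (there x∈ys) with x ≟ y
  ... | yes refl = ⊥-elim (All.lookup y∉ys x∈ys refl)
  ... | no _     = count-unique u x∈ys

  unique-same-members⇒↭ : ∀ {xs ys} → Unique xs → Unique ys →
    (∀ {z} → z ∈ xs → z ∈ ys) → (∀ {z} → z ∈ ys → z ∈ xs) → xs ↭ ys
  unique-same-members⇒↭ {xs} {ys} uxs uys xs⊆ys ys⊆xs = ↭-from-count xs ys same
    where
    same : ∀ z → count z xs ≡ count z ys
    same z with z ∈? xs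
    ... | yes z∈xs = trans (count-unique uxs z∈xs) (sym (count-unique uys (xs⊆ys z∈xs)))
    ... | no z∉xs  = trans (count-∉ xs z∉xs) (sym (count-∉ ys (z∉xs ∘ ys⊆xs)))

  map-unique : ∀ (f : X → X) {xs} → (∀ {a b} → a ∈ xs → b ∈ xs → f a ≡ f b → a ≡ b) →
    Unique xs → Unique (map f xs)
  map-unique f {[]}     inj []          = []
  map-unique f {x ∷ xs} inj (x∉xs ∷ u) =
    AllP.map⁺ (All.tabulate λ z∈xs fx≡fz → All.lookup x∉xs z∈xs (inj (here refl) (there z∈xs) fx≡fz))
    ∷ map-unique f (λ a∈ b∈ → inj (there a∈) (there b∈)) u

  bijection-permutes : ∀ {xs} → Unique xs → (ψ φ : X → X) →
    (∀ x → x ∈ xs → ψ x ∈ xs) → (∀ x → x ∈ xs → φ x ∈ xs) →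
    (∀ x → x ∈ xs → φ (ψ x) ≡ x) → (∀ x → x ∈ xs → ψ (φ x) ≡ x) →
    map ψ xs ↭ xs
  bijection-permutes {xs} u ψ φ ψ∈ φ∈ φψ ψφ =
    unique-same-members⇒↭ (map-unique ψ ψ-injective u) u image⊆ ⊆image
    where
    ψ-injective : ∀ {a b} → a ∈ xs → b ∈ xs → ψ a ≡ ψ b → a ≡ b
    ψ-injective {a} {b} a∈ b∈ e = trans (sym (φψ a a∈)) (trans (cong φ e) (φψ b b∈))
    image⊆ : ∀ {z} → z ∈ map ψ xs → z ∈ xs
    image⊆ z∈ with x , x∈ , refl ← ∈-map⁻ ψ z∈ = ψ∈ x x∈
    ⊆image : ∀ {z} → z ∈ xs → z ∈ map ψ xs
    ⊆image {z} z∈ = subst (_∈ map ψ xs) (ψφ z z∈) (∈-map⁺ ψ (φ∈ z z∈))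

init∷ʳlast : ∀ {A : Set} {m} (xs : Vec A (suc m)) → init xs ∷ʳ last xs ≡ xs
init∷ʳlast xs = sym (proj₂ (proj₂ (initLast xs)))

lookup-∷ʳ-inject₁ : ∀ {A : Set} {k} (xs : Vec A k) y i → lookup (xs ∷ʳ y) (Fin.inject₁ i) ≡ lookup xs i
lookup-∷ʳ-inject₁ (x ∷ xs) y Fin.zero    = refl
lookup-∷ʳ-inject₁ (x ∷ xs) y (Fin.suc i) = lookup-∷ʳ-inject₁ xs y i

lookup-∷ʳ-last : ∀ {A : Set} {k} (xs : Vec A k) y → lookup (xs ∷ʳ y) (Fin.fromℕ k) ≡ y
lookup-∷ʳ-last []       y = refl
lookup-∷ʳ-last (x ∷ xs) y = lookup-∷ʳ-last xs y

holes : ∀ {k} → Subset k → ℕ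
holes []           = 0
holes (true ∷ J)   = holes J
holes (false ∷ J)  = suc (holes J)

holes-∷ʳ : ∀ {k} (J : Subset k) b → holes (J ∷ʳ b) ≡ holes (b ∷ J)
holes-∷ʳ []          b     = refl
holes-∷ʳ (true ∷ J)  true  = holes-∷ʳ J true
holes-∷ʳ (true ∷ J)  false = holes-∷ʳ J false
holes-∷ʳ (false ∷ J) true  = cong suc (holes-∷ʳ J true)
holes-∷ʳ (false ∷ J) false = cong suc (holes-∷ʳ J false)

unshift : ∀ {m} → Subset (suc m) → Subset (suc m)
unshift (b ∷ J) = J ∷ʳ b

shift-injective : ∀ {n} {J K : Subset n} → shift J ≡ shift K → J ≡ K
shift-injective {zero}  e = e
shift-injective {suc m} {J} {K} e =
  trans (sym (init∷ʳlast J)) (trans (cong unshift e) (init∷ʳlast K))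

holes-shift : ∀ {n} (J : Subset n) → holes (shift J) ≡ holes J
holes-shift {zero}  J = refl
holes-shift {suc m} J = trans (sym (holes-∷ʳ (init J) (last J))) (cong holes (init∷ʳlast J))

iterate-invariant : ∀ {n} {A : Set} (c : Subset n → A) → (∀ J → c (shift J) ≡ c J) →
  ∀ J d → c (iterate shift J d) ≡ c J
iterate-invariant c inv J zero    = refl
iterate-invariant c inv J (suc d) = trans (iterate-invariant c inv (shift J) d) (inv J)

holes-zero : ∀ {k} (J : Subset k) → holes J ≡ 0 → J ≡ fullˢ
holes-zero []         _ = refl
holes-zero (true ∷ J) h = cong (true ∷_) (holes-zero J h)

hole-position : ∀ {k} (J : Subset k) {z} → holes J ≡ suc z → ∃ λ i → lookup J i ≡ false
hole-position (true ∷ J)  h with i , Ji ← hole-position J h = Fin.suc i , Ji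
hole-position (false ∷ J) h = Fin.zero , refl

lookup-shift : ∀ {m} (J : Subset (suc m)) (j : Fin m) → lookup (shift J) (Fin.suc j) ≡ lookup J (Fin.inject₁ j)
lookup-shift J j =
  trans (sym (lookup-∷ʳ-inject₁ (init J) (last J) j)) (cong (λ K → lookup K (Fin.inject₁ j)) (init∷ʳlast J))

rotate-to-last : ∀ {m} d (J : Subset (suc m)) (i : Fin (suc m)) → toℕ i + d ≡ m →
  ∃ λ xs → iterate shift J d ≡ xs ∷ʳ lookup J i
rotate-to-last {m} zero J i i≡m = init J , trans (sym (init∷ʳlast J)) (cong (init J ∷ʳ_) last≡Ji)
  where
  i≡last : i ≡ Fin.fromℕ m
  i≡last = FP.toℕ-injective (trans (trans (sym (ℕ.+-identityʳ _)) i≡m) (sym (FP.toℕ-fromℕ m)))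
  last≡Ji : last J ≡ lookup J i
  last≡Ji = begin
    last J                                   ≡⟨ sym (lookup-∷ʳ-last (init J) (last J)) ⟩
    lookup (init J ∷ʳ last J) (Fin.fromℕ m)  ≡⟨ cong₂ lookup (init∷ʳlast J) (sym i≡last) ⟩
    lookup J i                               ∎
    where open ≡-Reasoning
rotate-to-last {m} (suc d) J i i+d≡m =
  let xs , e = rotate-to-last d (shift J) (Fin.suc j) j+1+d≡m in
  xs , trans e (cong (xs ∷ʳ_) (trans (lookup-shift J j) (cong (lookup J) (FP.inject₁-lower₁ i m≢i))))
  where
  m≢i : m ≢ toℕ i
  m≢i m≡i = ℕ.m+1+n≢m (toℕ i) (trans i+d≡m m≡i)
  j : Fin m
  j = Fin.lower₁ i m≢i
  j+1+d≡m : suc (toℕ j + d) ≡ m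
  j+1+d≡m = trans (sym (ℕ.+-suc (toℕ j) d)) (trans (cong (_+ suc d) (FP.toℕ-lower₁ i m≢i)) i+d≡m)

rotate-hole-to-last : ∀ {m z} (J : Subset (suc m)) → holes J ≡ suc z →
  ∃ λ d → ∃ λ xs → iterate shift J d ≡ xs ∷ʳ false
rotate-hole-to-last {m} J h with i , Ji≡false ← hole-position J h =
  let xs , e = rotate-to-last (m ∸ toℕ i) J i (ℕ.m+[n∸m]≡n (s≤s⁻¹ (FP.toℕ<n i))) in
  m ∸ toℕ i , xs , trans e (cong (xs ∷ʳ_) Ji≡false)

-- Induction on the number of holes: a subset with a hole is rotated to
-- one missing m+1, whose multiplicity is the known total minus that of the subset
-- with m+1 added, which has one hole less.
module CyclicLift {m} (c₁ c₂ : Subset (suc m) → ℕ)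
  (rot₁ : ∀ J → c₁ (shift J) ≡ c₁ J) (rot₂ : ∀ J → c₂ (shift J) ≡ c₂ J)
  (full₁ : c₁ fullˢ ≡ 0) (full₂ : c₂ fullˢ ≡ 0)
  (linear : ∀ xs → c₁ (xs ∷ʳ false) + c₁ (xs ∷ʳ true) ≡ c₂ (xs ∷ʳ false) + c₂ (xs ∷ʳ true))
  where

  agree-with-holes : ∀ z J → holes J ≡ z → c₁ J ≡ c₂ J
  agree-with-holes zero J h with refl ← holes-zero J h = trans full₁ (sym full₂)
  agree-with-holes (suc z) J h with d , xs , e ← rotate-hole-to-last J h = begin
    c₁ J                    ≡⟨ sym (iterate-invariant c₁ rot₁ J d) ⟩
    c₁ (iterate shift J d)  ≡⟨ cong c₁ e ⟩
    c₁ (xs ∷ʳ false)        ≡⟨ ℕ.+-cancelʳ-≡ _ _ _ same-totals ⟩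
    c₂ (xs ∷ʳ false)        ≡⟨ cong c₂ (sym e) ⟩
    c₂ (iterate shift J d)  ≡⟨ iterate-invariant c₂ rot₂ J d ⟩
    c₂ J                    ∎
    where
    open ≡-Reasoning
    filled-holes : holes (xs ∷ʳ true) ≡ z
    filled-holes = ℕ.suc-injective (begin
      suc (holes (xs ∷ʳ true))  ≡⟨ cong suc (holes-∷ʳ xs true) ⟩
      holes (false ∷ xs)        ≡⟨ sym (holes-∷ʳ xs false) ⟩
      holes (xs ∷ʳ false)       ≡⟨ cong holes (sym e) ⟩
      holes (iterate shift J d) ≡⟨ iterate-invariant holes holes-shift J d ⟩
      holes J                   ≡⟨ h ⟩
      suc z                     ∎)
    filled-agree : c₁ (xs ∷ʳ true) ≡ c₂ (xs ∷ʳ true)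
    filled-agree = agree-with-holes z (xs ∷ʳ true) filled-holes
    same-totals : c₁ (xs ∷ʳ false) + c₁ (xs ∷ʳ true) ≡ c₂ (xs ∷ʳ false) + c₁ (xs ∷ʳ true)
    same-totals = trans (linear xs) (cong (c₂ (xs ∷ʳ false) +_) (sym filled-agree))

  agree : ∀ J → c₁ J ≡ c₂ J
  agree J = agree-with-holes (holes J) J refl

linearPart : ∀ {n} → Subset n → Subset n
linearPart {n} J = J ∩ below n

linearPart-∷ʳ : ∀ {k} (xs : Subset k) b → linearPart (xs ∷ʳ b) ≡ xs ∷ʳ false
linearPart-∷ʳ []           true  = refl
linearPart-∷ʳ []           false = refl
linearPart-∷ʳ (true ∷ xs)  b     = cong (true ∷_) (linearPart-∷ʳ xs b)
linearPart-∷ʳ (false ∷ xs) b     = cong (false ∷_) (linearPart-∷ʳ xs b)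

linearPart-fibre : ∀ {k} (xs : Subset k) J → linearPart J ≡ xs ∷ʳ false →
  J ≡ xs ∷ʳ false ⊎ J ≡ xs ∷ʳ true
linearPart-fibre xs J e = by-last (last J) J≡xs∷ʳlast
  where
  init≡xs : init J ≡ xs
  init≡xs = VP.∷ʳ-injectiveˡ (init J) xs (begin
    init J ∷ʳ false                ≡⟨ sym (linearPart-∷ʳ (init J) (last J)) ⟩
    linearPart (init J ∷ʳ last J)  ≡⟨ cong linearPart (init∷ʳlast J) ⟩
    linearPart J                   ≡⟨ e ⟩
    xs ∷ʳ false                    ∎)
    where open ≡-Reasoning
  J≡xs∷ʳlast : J ≡ xs ∷ʳ last J
  J≡xs∷ʳlast = trans (sym (init∷ʳlast J)) (cong (_∷ʳ last J) init≡xs)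
  by-last : ∀ b → J ≡ xs ∷ʳ b → J ≡ xs ∷ʳ false ⊎ J ≡ xs ∷ʳ true
  by-last false = inj₁
  by-last true  = inj₂

RotationInvariant : ∀ {n} → List (Subset n) → Set
RotationInvariant M = map shift M ↭ M

module SubsetMultiplicity {n : ℕ} = Multiplicity {Subset n} (VP.≡-dec Bool._≟_)
open SubsetMultiplicity

count-rotation : ∀ {n} {M : List (Subset n)} → RotationInvariant M → ∀ J → count (shift J) M ≡ count J M
count-rotation {M = M} rot J = trans (sym (count-↭ (shift J) rot)) (count-map-injective shift shift-injective J M)

count-linearPart : ∀ {k} (xs : Subset k) M →
  count (xs ∷ʳ false) (map linearPart M) ≡ count (xs ∷ʳ false) M + count (xs ∷ʳ true) M
count-linearPart xs = count-map-fibre₂ linearPart false≢true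
  (linearPart-∷ʳ xs false) (linearPart-∷ʳ xs true) (linearPart-fibre xs)
  where
  false≢true : xs ∷ʳ false ≢ xs ∷ʳ true
  false≢true e with () ← VP.∷ʳ-injectiveʳ xs xs e

linearPart-determines : ∀ {m} {M₁ M₂ : List (Subset (suc m))} →
  RotationInvariant M₁ → RotationInvariant M₂ → fullˢ ∉ M₁ → fullˢ ∉ M₂ →
  map linearPart M₁ ↭ map linearPart M₂ → M₁ ↭ M₂
linearPart-determines {M₁ = M₁} {M₂} rot₁ rot₂ full∉M₁ full∉M₂ linear =
  ↭-from-count M₁ M₂ (CyclicLift.agree (λ J → count J M₁) (λ J → count J M₂)
    (count-rotation rot₁) (count-rotation rot₂)
    (count-∉ M₁ full∉M₁) (count-∉ M₂ full∉M₂)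
    λ xs → trans (sym (count-linearPart xs M₁))
             (trans (count-↭ (xs ∷ʳ false) linear) (count-linearPart xs M₂)))

equivariant-image : ∀ {n} {X : Set} → DecidableEquality X → (c : X → Subset n) →
  ∀ {xs} → Unique xs → (ψ φ : X → X) →
  (∀ x → x ∈ xs → ψ x ∈ xs) → (∀ x → x ∈ xs → φ x ∈ xs) →
  (∀ x → x ∈ xs → φ (ψ x) ≡ x) → (∀ x → x ∈ xs → ψ (φ x) ≡ x) →
  (∀ x → x ∈ xs → c (ψ x) ≡ shift (c x)) →
  RotationInvariant (map c xs)
equivariant-image _≟_ c {xs} u ψ φ ψ∈ φ∈ φψ ψφ equivariant = begin
  map shift (map c xs)  ≡⟨ LP.map-∘ xs ⟨
  map (shift ∘ c) xs    ≡⟨ LP.map-cong-local (All.tabulate λ {x} x∈ → sym (equivariant x x∈)) ⟩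
  map (c ∘ ψ) xs        ≡⟨ LP.map-∘ xs ⟩
  map c (map ψ xs)      ↭⟨ PermP.map⁺ c (Multiplicity.bijection-permutes _≟_ u ψ φ ψ∈ φ∈ φψ ψφ) ⟩
  map c xs              ∎
  where open PermutationReasoning

∩-tabulate : ∀ {n} (f g : Fin n → Bool) → tabulate f ∩ tabulate g ≡ tabulate (λ k → g k ∧ f k)
∩-tabulate {zero}  f g = refl
∩-tabulate {suc n} f g = cong₂ _∷_ (BoolP.∧-comm (f Fin.zero) (g Fin.zero)) (∩-tabulate (f ∘ Fin.suc) (g ∘ Fin.suc))

linearPart-cDes : ∀ {n} (π : Perm n) → linearPart (cDes π) ≡ Des π
linearPart-cDes π = ∩-tabulate _ _

-- every sequence has a cyclic ascent, at the position of its minimal value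
cDes-proper : ∀ {m} (π : Perm (suc m)) → cDes π ≢ fullˢ
cDes-proper {m} π cDes≡full = ℕ.<⇒≱ descent (minimal (cyc k))
  where
  value : Fin (suc m) → ℕ
  value = toℕ ∘ lookup π
  k : Fin (suc m)
  k = argmin value Fin.zero (allFin (suc m))
  minimal : ∀ j → value k ≤ value j
  minimal j = All.lookup (f[argmin]≤f[xs] {f = value} Fin.zero (allFin (suc m))) (∈-allFin j)
  k∈cDes : (value (cyc k) <ᵇ value k) ≡ true
  k∈cDes = begin
    value (cyc k) <ᵇ value k  ≡⟨ VP.lookup∘tabulate (λ i → value (cyc i) <ᵇ value i) k ⟨
    lookup (cDes π) k         ≡⟨ cong (λ J → lookup J k) cDes≡full ⟩
    lookup fullˢ k            ≡⟨ VP.lookup-replicate k true ⟩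
    true                      ∎
    where open ≡-Reasoning
  descent : value (cyc k) < value k
  descent = ℕ.<ᵇ⇒< (value (cyc k)) (value k) (subst T (sym k∈cDes) _)

cDes-determined : ∀ {n} (πs : List (Perm n)) {M : List (Subset n)} →
  RotationInvariant (map cDes πs) → RotationInvariant M → fullˢ ∉ M →
  map Des πs ↭ map linearPart M → map cDes πs ↭ M
cDes-determined {zero} πs _ _ _ Des≈ =
  subst₂ _↭_ (LP.map-cong (λ _ → refl) πs) (LP.map-id-local (All.tabulate λ { {[]} _ → refl })) Des≈
cDes-determined {suc m} πs {M} rotπs rotM full∉M Des≈ =
  linearPart-determines rotπs rotM full∉cDes full∉M
    (subst (_↭ map linearPart M) (trans (sym (LP.map-cong linearPart-cDes πs)) (LP.map-∘ πs)) Des≈)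
  where
  full∉cDes : fullˢ ∉ map cDes πs
  full∉cDes full∈ with π , _ , full≡ ← ∈-map⁻ cDes full∈ = cDes-proper π (sym full≡)

module SchurExpansion (n : ℕ) (enum : (s : SkewShape n) → List (Tab n))
  (enumerates : (s : SkewShape n) → Enumerates (IsSYT s) (enum s)) where

  open Enumerates

  isSYT : ∀ s {T} → T ∈ enum s → IsSYT s T
  isSYT s {T} T∈ = sound (enumerates s) T T∈

  listed : ∀ s {T} → IsSYT s T → T ∈ enum s
  listed s {T} = complete (enumerates s) T

  extension-rotation-invariant : ∀ s (e : CycDesExt s) → RotationInvariant (map (cDesT e) (enum s))
  extension-rotation-invariant s e =
    equivariant-image (VP.≡-dec (ProdP.≡-dec ℕ._≟_ ℕ._≟_)) (cDesT e) (nodupE (enumerates s)) (ψ e) (ψ⁻¹ e)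
      (λ T T∈ → listed s (ψ-syt e T (isSYT s T∈)))
      (λ T T∈ → listed s (ψ⁻¹-syt e T (isSYT s T∈)))
      (λ T T∈ → ψ⁻¹ψ e T (isSYT s T∈))
      (λ T T∈ → ψψ⁻¹ e T (isSYT s T∈))
      (λ T T∈ → equivar e T (isSYT s T∈))

  rotation-invariant : ∀ L (exts : All CycDesExt L) → RotationInvariant (schurCDesGF enum L exts)
  rotation-invariant []      []       = ↭-refl
  rotation-invariant (s ∷ L) (e ∷ es) = begin
    map shift (map (cDesT e) (enum s) ++ schurCDesGF enum L es)
      ≡⟨ LP.map-++ shift (map (cDesT e) (enum s)) (schurCDesGF enum L es) ⟩
    map shift (map (cDesT e) (enum s)) ++ map shift (schurCDesGF enum L es)
      ↭⟨ PermP.++⁺ (extension-rotation-invariant s e) (rotation-invariant L es) ⟩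
    map (cDesT e) (enum s) ++ schurCDesGF enum L es
      ∎
    where open PermutationReasoning

  full∉ : ∀ L (exts : All CycDesExt L) → fullˢ ∉ schurCDesGF enum L exts
  full∉ (s ∷ L) (e ∷ es) full∈ with ∈-++⁻ (map (cDesT e) (enum s)) full∈
  ... | inj₂ full∈rest = full∉ L es full∈rest
  ... | inj₁ full∈here with T , T∈ , full≡ ← ∈-map⁻ (cDesT e) full∈here =
    nonFull e T (isSYT s T∈) (sym full≡)

  linearPart-expansion : ∀ L (exts : All CycDesExt L) →
    map linearPart (schurCDesGF enum L exts) ≡ schurDesGF enum L
  linearPart-expansion []      []       = refl
  linearPart-expansion (s ∷ L) (e ∷ es) = begin
    map linearPart (map (cDesT e) (enum s) ++ schurCDesGF enum L es)
      ≡⟨ LP.map-++ linearPart (map (cDesT e) (enum s)) (schurCDesGF enum L es) ⟩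
    map linearPart (map (cDesT e) (enum s)) ++ map linearPart (schurCDesGF enum L es)
      ≡⟨ cong₂ _++_ extends-here (linearPart-expansion L es) ⟩
    map DesT (enum s) ++ schurDesGF enum L
      ∎
    where
    open ≡-Reasoning
    extends-here : map linearPart (map (cDesT e) (enum s)) ≡ map DesT (enum s)
    extends-here = trans (sym (LP.map-∘ (enum s)))
      (LP.map-cong-local (All.tabulate λ {T} T∈ → extends e T (isSYT s T∈)))

lemma3p9 : (n : ℕ) (A : PermSet n) → CDesInvariant A →
    (enum : (s : SkewShape n) → List (Tab n)) →
    ((s : SkewShape n) → Enumerates (IsSYT s) (enum s)) →
    (L : List (SkewShape n)) → All (λ s → ¬ ConnectedRibbon s) L →
    map Des (elems A) ↭ schurDesGF enum L →
    Σ (List (SkewShape n)) λ L′ →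
    All (λ s → ¬ ConnectedRibbon s) L′ ×
    ((exts : All CycDesExt L′) → map cDes (elems A) ↭ schurCDesGF enum L′ exts)
lemma3p9 n A (ψ , φ , ψ∈ , φ∈ , φψ , ψφ , equivariant) enum enumerates L noRibbon Des-expansion =
  L , noRibbon , λ exts →
    cDes-determined (elems A)
      (equivariant-image (VP.≡-dec Fin._≟_) cDes (nodup A) ψ φ ψ∈ φ∈ φψ ψφ equivariant)
      (rotation-invariant L exts)
      (full∉ L exts)
      (subst (map Des (elems A) ↭_) (sym (linearPart-expansion L exts)) Des-expansion)
  where open SchurExpansion n enum enumerates
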